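{- Let $n \ge 2$, let $p_n < p_{n+1}$ be consecutive primes, and let $m = (p_n+p_{n+1})/2$. Let $c_n$ be the number of odd multiples of $p_n$ lying in the interval $(p_np_{n+1}, m^2]$, and let $c_{n+1}$ be the number of odd multiples of $p_{n+1}$ lying in the interval $(p_np_{n+1}, m^2]$. Then $c_{n+1} \le c_n$.
   Context: $p_n$ denotes the $n$-th prime. For $n\ge 2$ both primes are odd, so $m$ is an integer, and $p_np_{n+1} < m^2$. Equivalently, if $\alpha p_n$ is the largest odd multiple of $p_n$ not exceeding $m^2$ and $\beta p_{n+1}$ the largest odd multiple of $p_{n+1}$ not exceeding $m^2$, then $\alpha = p_{n+1}+2c_n$ and $\beta = p_n + 2c_{n+1}$. -}

module Defs where

open import Data.Nat using (ℕ; zero; suc; _+_; _*_; _<_; _≤_)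
open import Data.Nat.Primality using (Prime)
open import Data.Nat.Divisibility using (_∣_; _∣?_)
open import Data.Nat.Properties using (_<?_; _≤?_)
open import Data.List using (List; filter; length; upTo)
open import Data.Product using (_×_)
open import Relation.Nullary using (¬_)
open import Relation.Nullary.Decidable using (_×-dec_; ¬?)

Odd : ℕ → Set
Odd k = ¬ (2 ∣ k)

ConsecutivePrimes : ℕ → ℕ → Set
ConsecutivePrimes p q = Prime p × Prime q × p < q × (∀ r → p < r → r < q → ¬ Prime r)

oddMultiplesIn : ℕ → ℕ → ℕ → ℕ
oddMultiplesIn d a b =
  length (filter (λ k → (a <? k) ×-dec (k ≤? b) ×-dec ¬? (2 ∣? k) ×-dec (d ∣? k))
                 (upTo (suc b)))

module Submission where

-- Write d = q ∸ p for odd numbers p ≤ q.  An odd multiple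
-- k * q of q in (p * q, B] has an odd multiplier k > p, and the "shift"
--     k * q  ↦  (k + d) * p
-- sends it to an odd multiple of p in the same interval: k + d is odd because
-- d is even, (k + d) * p > (p + d) * p = p * q, and
-- (k + d) * p = k * p + d * p ≤ k * p + d * k = k * q ≤ B.  The shift is
-- injective, so there are at most as many odd multiples of q as of p in
-- (p * q, B].

open import Defs
open import Data.Nat using (ℕ; zero; suc; _+_; _*_; _∸_; _/_; _≤_; _<_; NonZero; z≤n; s≤s)
open import Data.Nat.Properties
open import Data.Nat.DivMod using (m*n/n≡m)
open import Data.Nat.Divisibility
open import Data.Nat.Primality using (Prime; prime⇒irreducible; euclidsLemma; prime[2])
open import Data.List using (List; []; _∷_; filter; length; upTo)
open import Data.List.Membership.Propositional using (_∈_)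
open import Data.List.Membership.Propositional.Properties using (∈-filter⁺; ∈-filter⁻; ∈-upTo⁺)
open import Data.List.Properties using (length-removeAt′)
open import Data.List.Relation.Unary.Any using (here; there; index; _─_)
import Data.List.Relation.Unary.All as All
open import Data.List.Relation.Unary.AllPairs using (_∷_)
open import Data.List.Relation.Unary.Unique.Propositional using (Unique)
import Data.List.Relation.Unary.Unique.Propositional.Properties as Unique
open import Data.Product using (_×_; _,_)
open import Data.Sum using (inj₁; inj₂)
open import Relation.Nullary using (contradiction)
open import Relation.Nullary.Decidable using (_×-dec_; ¬?)
open import Relation.Unary using (Decidable)
open import Relation.Binary.PropositionalEquality

∈-─ : ∀ {A : Set} {x y : A} {ys : List A} (x∈ys : x ∈ ys) → y ∈ ys → y ≢ x → y ∈ (ys ─ x∈ys)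
∈-─ (here refl)  (here refl)  y≢x = contradiction refl y≢x
∈-─ (here refl)  (there y∈ys) y≢x = y∈ys
∈-─ (there x∈ys) (here refl)  y≢x = here refl
∈-─ (there x∈ys) (there y∈ys) y≢x = there (∈-─ x∈ys y∈ys y≢x)

length-≤-injection : ∀ {A B : Set} (f : A → B) (xs : List A) (ys : List B) → Unique xs →
  (∀ {x y} → x ∈ xs → y ∈ xs → f x ≡ f y → x ≡ y) →
  (∀ {x} → x ∈ xs → f x ∈ ys) → length xs ≤ length ys
length-≤-injection f []       ys _              _   _    = z≤n
length-≤-injection f (x ∷ xs) ys (x∉xs ∷ uniq) inj into = begin
  suc (length xs)            ≤⟨ s≤s (length-≤-injection f xs (ys ─ fx∈ys) uniq inj′ into′) ⟩
  suc (length (ys ─ fx∈ys))  ≡⟨ length-removeAt′ ys (index fx∈ys) ⟨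
  length ys                  ∎
  where
  open ≤-Reasoning
  fx∈ys : f x ∈ ys
  fx∈ys = into (here refl)
  inj′ : ∀ {y z} → y ∈ xs → z ∈ xs → f y ≡ f z → y ≡ z
  inj′ y∈xs z∈xs = inj (there y∈xs) (there z∈xs)
  -- the images of the tail avoid f x, since the tail avoids x
  into′ : ∀ {y} → y ∈ xs → f y ∈ (ys ─ fx∈ys)
  into′ y∈xs = ∈-─ fx∈ys (into (there y∈xs))
    (λ fy≡fx → All.lookup x∉xs y∈xs (sym (inj (there y∈xs) (here refl) fy≡fx)))

Even : ℕ → Set
Even n = 2 ∣ n

odd⇒nonZero : ∀ {n} → Odd n → NonZero n
odd⇒nonZero {zero}  odd = contradiction (2 ∣0) odd
odd⇒nonZero {suc n} _   = _

odd⇒even-suc : ∀ {n} → Odd n → Even (suc n)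
odd⇒even-suc {zero}        odd = contradiction (2 ∣0) odd
odd⇒even-suc {suc zero}    _   = ∣-refl
odd⇒even-suc {suc (suc n)} odd =
  ∣m∣n⇒∣m+n ∣-refl (odd⇒even-suc (λ 2∣n → odd (∣m∣n⇒∣m+n ∣-refl 2∣n)))

odd-∸-odd : ∀ {m n} → Odd m → Odd n → m ≤ n → Even (n ∸ m)
odd-∸-odd {m} {n} odd-m odd-n m≤n = ∣m+n∣m⇒∣n 2∣1+m+[n∸m] (odd⇒even-suc odd-m)
  where
  2∣1+m+[n∸m] : Even (suc m + (n ∸ m))
  2∣1+m+[n∸m] = subst Even (cong suc (sym (m+[n∸m]≡n m≤n))) (odd⇒even-suc odd-n)

odd+even : ∀ {m n} → Odd m → Even n → Odd (m + n)
odd+even {m} {n} odd-m even-n 2∣m+n = odd-m (∣m+n∣m⇒∣n (subst Even (+-comm m n) 2∣m+n) even-n)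

odd*odd : ∀ {m n} → Odd m → Odd n → Odd (m * n)
odd*odd {m} {n} odd-m odd-n 2∣m*n with euclidsLemma m n prime[2] 2∣m*n
... | inj₁ 2∣m = odd-m 2∣m
... | inj₂ 2∣n = odd-n 2∣n

prime⇒odd : ∀ {p} → Prime p → 3 ≤ p → Odd p
prime⇒odd prime-p 3≤p 2∣p with prime⇒irreducible prime-p 2∣p
... | inj₁ ()
... | inj₂ refl = <-irrefl refl 3≤p

OddMultipleIn : ℕ → ℕ → ℕ → ℕ → Set
OddMultipleIn d a b k = a < k × k ≤ b × Odd k × d ∣ k

oddMultipleIn? : ∀ d a b → Decidable (OddMultipleIn d a b)
oddMultipleIn? d a b k = (a <? k) ×-dec (k ≤? b) ×-dec ¬? (2 ∣? k) ×-dec (d ∣? k)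

oddMultiples : ℕ → ℕ → ℕ → List ℕ
oddMultiples d a b = filter (oddMultipleIn? d a b) (upTo (suc b))

oddMultiples-unique : ∀ d a b → Unique (oddMultiples d a b)
oddMultiples-unique d a b = Unique.filter⁺ (oddMultipleIn? d a b) (Unique.upTo⁺ (suc b))

∈-oddMultiples⁻ : ∀ d a b {k} → k ∈ oddMultiples d a b → OddMultipleIn d a b k
∈-oddMultiples⁻ d a b k∈
  with _ , k-odd ← ∈-filter⁻ (oddMultipleIn? d a b) {xs = upTo (suc b)} k∈ = k-odd

∈-oddMultiples⁺ : ∀ d a b {k} → OddMultipleIn d a b k → k ∈ oddMultiples d a b
∈-oddMultiples⁺ d a b k-odd@(_ , k≤b , _) =
  ∈-filter⁺ (oddMultipleIn? d a b) (∈-upTo⁺ (s≤s k≤b)) k-odd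

module Shift {p q : ℕ} (odd-p : Odd p) (odd-q : Odd q) (p≤q : p ≤ q) where

  instance
    nonZero-p : NonZero p
    nonZero-p = odd⇒nonZero odd-p
    nonZero-q : NonZero q
    nonZero-q = odd⇒nonZero odd-q

  d : ℕ
  d = q ∸ p

  p+d≡q : p + d ≡ q
  p+d≡q = m+[n∸m]≡n p≤q

  shift : ℕ → ℕ
  shift x = (x / q + d) * p

  shift-multiple : ∀ k → shift (k * q) ≡ (k + d) * p
  shift-multiple k = cong (λ j → (j + d) * p) (m*n/n≡m k q)

  shift-lower : ∀ {k} → p < k → p * q < (k + d) * p
  shift-lower {k} p<k = begin-strict
    p * q        ≡⟨ cong (p *_) p+d≡q ⟨
    p * (p + d)  ≡⟨ *-comm p (p + d) ⟩
    (p + d) * p  <⟨ *-monoˡ-< p (+-monoˡ-< d p<k) ⟩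
    (k + d) * p  ∎
    where open ≤-Reasoning

  shift-upper : ∀ {k} → p < k → (k + d) * p ≤ k * q
  shift-upper {k} p<k = begin
    (k + d) * p    ≡⟨ *-distribʳ-+ p k d ⟩
    k * p + d * p  ≤⟨ +-monoʳ-≤ (k * p) (*-monoʳ-≤ d (<⇒≤ p<k)) ⟩
    k * p + d * k  ≡⟨ cong (k * p +_) (*-comm d k) ⟩
    k * p + k * d  ≡⟨ *-distribˡ-+ k p d ⟨
    k * (p + d)    ≡⟨ cong (k *_) p+d≡q ⟩
    k * q          ∎
    where open ≤-Reasoning

  shift-into : ∀ {B x} → OddMultipleIn q (p * q) B x → OddMultipleIn p (p * q) B (shift x)
  shift-into {B} (pq<kq , kq≤B , odd-kq , divides-refl k) =
    subst (OddMultipleIn p (p * q) B) (sym (shift-multiple k))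
      ( shift-lower p<k
      , ≤-trans (shift-upper p<k) kq≤B
      , odd*odd (odd+even odd-k (odd-∸-odd odd-p odd-q p≤q)) odd-p
      , n∣m*n (k + d) )
    where
    p<k : p < k
    p<k = *-cancelʳ-< q p k pq<kq
    odd-k : Odd k
    odd-k 2∣k = odd-kq (∣m⇒∣m*n q 2∣k)

  shift-injective : ∀ {a b x y} → OddMultipleIn q a b x → OddMultipleIn q a b y →
    shift x ≡ shift y → x ≡ y
  shift-injective (_ , _ , _ , divides-refl k) (_ , _ , _ , divides-refl j) eq =
    cong (_* q) (+-cancelʳ-≡ d k j (*-cancelʳ-≡ (k + d) (j + d) p
      (trans (sym (shift-multiple k)) (trans eq (shift-multiple j)))))

oddMultiplesIn-shift-≤ : ∀ {p q} → Odd p → Odd q → p ≤ q → ∀ B →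
  oddMultiplesIn q (p * q) B ≤ oddMultiplesIn p (p * q) B
oddMultiplesIn-shift-≤ {p} {q} odd-p odd-q p≤q B =
  length-≤-injection shift (oddMultiples q (p * q) B) (oddMultiples p (p * q) B)
    (oddMultiples-unique q (p * q) B)
    (λ x∈ y∈ → shift-injective (from-q x∈) (from-q y∈))
    (λ x∈ → ∈-oddMultiples⁺ p (p * q) B (shift-into (from-q x∈)))
  where
  open Shift odd-p odd-q p≤q
  from-q : ∀ {x} → x ∈ oddMultiples q (p * q) B → OddMultipleIn q (p * q) B x
  from-q = ∈-oddMultiples⁻ q (p * q) B

lemma2p1 : ∀ (p q : ℕ) → ConsecutivePrimes p q → 3 ≤ p →
    oddMultiplesIn q (p * q) (((p + q) / 2) * ((p + q) / 2))
      ≤ oddMultiplesIn p (p * q) (((p + q) / 2) * ((p + q) / 2))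
lemma2p1 p q (prime-p , prime-q , p<q , _) 3≤p =
  oddMultiplesIn-shift-≤ odd-p odd-q (<⇒≤ p<q) (((p + q) / 2) * ((p + q) / 2))
  where
  odd-p : Odd p
  odd-p = prime⇒odd prime-p 3≤p
  odd-q : Odd q
  odd-q = prime⇒odd prime-q (≤-trans 3≤p (<⇒≤ p<q))
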